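{- Let $P\subset\mathbb{R}^3$ be a lattice polytope with $\Delta_P(x)=l_1\leq\Delta_P(y)=l_2\leq\Delta_P(z)=l$, where $l_1\geq1$. If $a,b\in\mathbb{Z}$ satisfy $\Delta_P(ax+by+z)<l$, then $$|a|\leq\frac{2l-1+|b|l_2}{l_1}\quad\text{and}\quad|b|\leq\frac{2l-1+|a|l_1}{l_2}.$$
   Context: A lattice polytope is the convex hull of finitely many points of $\mathbb{Z}^3$. For a linear function $f$ with integer coefficients, $\Delta_P(f)=\max_{p\in P}f(p)-\min_{p\in P}f(p)$. -}

module Defs where

open import Data.Integer using (ℤ; _+_; _*_; _-_; _⊔_; _⊓_; +_)
open import Data.Product using (_×_; _,_)
open import Data.List using (List; foldr)

Point : Set
Point = ℤ × ℤ × ℤ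

LinFun : Set
LinFun = ℤ × ℤ × ℤ

eval : LinFun → Point → ℤ
eval (c₁ , c₂ , c₃) (x , y , z) = c₁ * x + c₂ * y + c₃ * z

-- A lattice polytope P = conv(S) given by a nonempty finite set S ⊂ ℤ³ of
-- generating lattice points (first point, remaining points).
record LatticePolytope : Set where
  constructor conv
  field
    p₀   : Point
    rest : List Point
open LatticePolytope public

-- max / min of a linear function over P. A linear function on conv(S)
-- attains its max and min at points of S, so these are max_{p∈P} f(p)
-- and min_{p∈P} f(p).
maxOn : LatticePolytope → LinFun → ℤ
maxOn P f = foldr (λ p m → eval f p ⊔ m) (eval f (p₀ P)) (rest P)

minOn : LatticePolytope → LinFun → ℤ
minOn P f = foldr (λ p m → eval f p ⊓ m) (eval f (p₀ P)) (rest P)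

Δ : LatticePolytope → LinFun → ℤ
Δ P f = maxOn P f - minOn P f

fx fy fz : LinFun
fx = (+ 1 , + 0 , + 0)
fy = (+ 0 , + 1 , + 0)
fz = (+ 0 , + 0 , + 1)

{-# OPTIONS --safe #-}
module Submission where

-- Pick generators p, q realising the x-width l₁, ordered by the sign of a so
-- that a (x_p − x_q) = |a| l₁. With f = ax + by + z we have ax = f − by − z, so
-- a (x_p − x_q) = (f p − f q) + b (y_q − y_p) + (z_q − z_p) ≤ (l − 1) + |b| l₂ + l,
-- every difference of values of a linear function on P being at most its width.

open import Defs
open import Algebra.Core using (Op₂)
open import Algebra.Definitions using (Selective)
open import Data.Integer using (ℤ; +_; -[1+_]; _+_; _*_; _-_; -_; _⊔_; _⊓_; _≤_; _≥_; _<_; ∣_∣; pred)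
open import Data.Integer.Properties
open import Data.Integer.Tactic.RingSolver using (solve-∀)
open import Data.List using (List; []; _∷_; foldr)
open import Data.List.Membership.Propositional using (_∈_)
open import Data.List.Relation.Unary.Any using (here; there)
open import Data.Nat using (suc)
open import Data.Product using (_×_; _,_; ∃-syntax; ∃₂)
open import Data.Sum using (inj₁; inj₂)
open import Function using (flip)
open import Level using (0ℓ)
open import Relation.Binary.Core using (Rel)
open import Relation.Binary.Definitions using (Reflexive; Transitive)
open import Relation.Binary.PropositionalEquality using (_≡_; refl; sym; trans; cong; cong₂; module ≡-Reasoning)

module _ {A : Set} (g : A → ℤ) (_•_ : Op₂ ℤ) where

  extremum : A → List A → ℤ
  extremum x xs = foldr (λ p m → g p • m) (g x) xs

  extremum-attained : Selective _≡_ _•_ → ∀ x xs →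
    ∃[ p ] p ∈ x ∷ xs × g p ≡ extremum x xs
  extremum-attained •-sel x [] = x , here refl , refl
  extremum-attained •-sel x (y ∷ ys) with •-sel (g y) (extremum x ys)
  ... | inj₁ e = y , there (here refl) , sym e
  ... | inj₂ e with extremum-attained •-sel x ys
  ...   | p , here p≡x , gp≡ = p , here p≡x , trans gp≡ (sym e)
  ...   | p , there p∈ys , gp≡ = p , there (there p∈ys) , trans gp≡ (sym e)

  extremum-bound : {_≼_ : Rel ℤ 0ℓ} → Reflexive _≼_ → Transitive _≼_ →
    (∀ i j → i ≼ (i • j)) → (∀ i j → j ≼ (i • j)) →
    ∀ {x p} xs → p ∈ x ∷ xs → g p ≼ extremum x xs
  extremum-bound refl′ _ _ _ [] (here refl) = refl′
  extremum-bound refl′ trans′ left right (y ∷ ys) (here refl) =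
    trans′ (extremum-bound refl′ trans′ left right ys (here refl)) (right (g y) _)
  extremum-bound refl′ trans′ left right (y ∷ ys) (there (here refl)) = left (g y) _
  extremum-bound refl′ trans′ left right (y ∷ ys) (there (there p∈ys)) =
    trans′ (extremum-bound refl′ trans′ left right ys (there p∈ys)) (right (g y) _)

generators : LatticePolytope → List Point
generators P = p₀ P ∷ rest P

maxOn-attained : ∀ P f → ∃[ p ] p ∈ generators P × eval f p ≡ maxOn P f
maxOn-attained P f = extremum-attained (eval f) _⊔_ ⊔-sel (p₀ P) (rest P)

minOn-attained : ∀ P f → ∃[ p ] p ∈ generators P × eval f p ≡ minOn P f
minOn-attained P f = extremum-attained (eval f) _⊓_ ⊓-sel (p₀ P) (rest P)

≤-maxOn : ∀ P f {p} → p ∈ generators P → eval f p ≤ maxOn P f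
≤-maxOn P f = extremum-bound (eval f) _⊔_ ≤-refl ≤-trans i≤i⊔j i≤j⊔i (rest P)

minOn-≤ : ∀ P f {p} → p ∈ generators P → minOn P f ≤ eval f p
minOn-≤ P f = extremum-bound (eval f) _⊓_ {_≥_} ≤-refl (flip ≤-trans) i⊓j≤i i⊓j≤j (rest P)

δ : LinFun → Point → Point → ℤ
δ f p q = eval f p - eval f q

δ≤Δ : ∀ P f {p q} → p ∈ generators P → q ∈ generators P → δ f p q ≤ Δ P f
δ≤Δ P f p∈P q∈P = +-mono-≤ (≤-maxOn P f p∈P) (neg-mono-≤ (minOn-≤ P f q∈P))

Δ-attained : ∀ P f → ∃₂ λ p q → p ∈ generators P × q ∈ generators P × δ f p q ≡ Δ P f
Δ-attained P f with maxOn-attained P f | minOn-attained P f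
... | p , p∈P , p-max | q , q∈P , q-min = p , q , p∈P , q∈P , cong₂ _-_ p-max q-min

-c*δpq≡c*δqp : ∀ c f p q → (- c) * δ f p q ≡ c * δ f q p
-c*δpq≡c*δqp c f p q = identity c (eval f p) (eval f q)
  where
  identity : ∀ c u v → (- c) * (u - v) ≡ c * (v - u)
  identity = solve-∀

c*δ≤∣c∣*Δ : ∀ P f c {p q} → p ∈ generators P → q ∈ generators P → c * δ f p q ≤ + ∣ c ∣ * Δ P f
c*δ≤∣c∣*Δ P f (+ n) p∈P q∈P = *-monoˡ-≤-nonNeg (+ n) (δ≤Δ P f p∈P q∈P)
c*δ≤∣c∣*Δ P f -[1+ n ] {p} {q} p∈P q∈P = begin
  -[1+ n ] * δ f p q  ≡⟨ -c*δpq≡c*δqp (+ suc n) f p q ⟩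
  + suc n * δ f q p   ≤⟨ *-monoˡ-≤-nonNeg (+ suc n) (δ≤Δ P f q∈P p∈P) ⟩
  + suc n * Δ P f     ∎
  where open ≤-Reasoning

∣c∣*Δ-attained : ∀ P f c → ∃₂ λ p q → p ∈ generators P × q ∈ generators P × c * δ f p q ≡ + ∣ c ∣ * Δ P f
∣c∣*Δ-attained P f c with Δ-attained P f
∣c∣*Δ-attained P f (+ n) | p , q , p∈P , q∈P , e = p , q , p∈P , q∈P , cong (+ n *_) e
∣c∣*Δ-attained P f -[1+ n ] | p , q , p∈P , q∈P , e =
  q , p , q∈P , p∈P , trans (-c*δpq≡c*δqp (+ suc n) f q p) (cong (+ suc n *_) e)

c*δ-split : ∀ (g f h k : LinFun) (c d : ℤ) →
  (∀ p → c * eval g p ≡ eval f p - d * eval h p - eval k p) →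
  ∀ p q → c * δ g p q ≡ δ f p q + d * δ h q p + δ k q p
c*δ-split g f h k c d split p q = begin
  c * δ g p q                                ≡⟨ distrib c (eval g p) (eval g q) ⟩
  c * eval g p - c * eval g q                ≡⟨ cong₂ _-_ (split p) (split q) ⟩
  (eval f p - d * eval h p - eval k p)
    - (eval f q - d * eval h q - eval k q)   ≡⟨ regroup d (eval f p) (eval f q) (eval h p) (eval h q) (eval k p) (eval k q) ⟩
  δ f p q + d * δ h q p + δ k q p            ∎
  where
  open ≡-Reasoning
  distrib : ∀ c u v → c * (u - v) ≡ c * u - c * v
  distrib = solve-∀
  regroup : ∀ d fp fq hp hq kp kq →
    (fp - d * hp - kp) - (fq - d * hq - kq) ≡ (fp - fq) + d * (hq - hp) + (kq - kp)
  regroup = solve-∀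

∣c∣*Δ≤Δ+∣d∣*Δ+Δ : ∀ P (g f h k : LinFun) (c d : ℤ) →
  (∀ p → c * eval g p ≡ eval f p - d * eval h p - eval k p) →
  + ∣ c ∣ * Δ P g ≤ Δ P f + + ∣ d ∣ * Δ P h + Δ P k
∣c∣*Δ≤Δ+∣d∣*Δ+Δ P g f h k c d split with ∣c∣*Δ-attained P g c
... | p , q , p∈P , q∈P , e = begin
  + ∣ c ∣ * Δ P g                    ≡⟨ sym e ⟩
  c * δ g p q                        ≡⟨ c*δ-split g f h k c d split p q ⟩
  δ f p q + d * δ h q p + δ k q p    ≤⟨ +-mono-≤ (+-mono-≤ (δ≤Δ P f p∈P q∈P) (c*δ≤∣c∣*Δ P h d q∈P p∈P)) (δ≤Δ P k q∈P p∈P) ⟩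
  Δ P f + + ∣ d ∣ * Δ P h + Δ P k    ∎
  where open ≤-Reasoning

i<j⇒i+k+j≤2j-1+k : ∀ {i j} k → i < j → i + k + j ≤ + 2 * j - + 1 + k
i<j⇒i+k+j≤2j-1+k {i} {j} k i<j = begin
  i + k + j       ≤⟨ +-monoˡ-≤ j (+-monoˡ-≤ k (i<j⇒i≤pred[j] i<j)) ⟩
  pred j + k + j  ≡⟨ identity j k ⟩
  + 2 * j - + 1 + k ∎
  where
  open ≤-Reasoning
  identity : ∀ j k → - + 1 + j + k + j ≡ + 2 * j - + 1 + k
  identity = solve-∀

ax≡f-by-z : ∀ a b p → a * eval fx p ≡ eval (a , b , + 1) p - b * eval fy p - eval fz p
ax≡f-by-z a b (x , y , z) = identity a b x y z
  where
  identity : ∀ a b x y z →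
    a * (+ 1 * x + + 0 * y + + 0 * z)
      ≡ (a * x + b * y + + 1 * z) - b * (+ 0 * x + + 1 * y + + 0 * z) - (+ 0 * x + + 0 * y + + 1 * z)
  identity = solve-∀

by≡f-ax-z : ∀ a b p → b * eval fy p ≡ eval (a , b , + 1) p - a * eval fx p - eval fz p
by≡f-ax-z a b (x , y , z) = identity a b x y z
  where
  identity : ∀ a b x y z →
    b * (+ 0 * x + + 1 * y + + 0 * z)
      ≡ (a * x + b * y + + 1 * z) - a * (+ 1 * x + + 0 * y + + 0 * z) - (+ 0 * x + + 0 * y + + 1 * z)
  identity = solve-∀

mainTheorem6 : (P : LatticePolytope) (l₁ l₂ l : ℤ) →
    Δ P fx ≡ l₁ → Δ P fy ≡ l₂ → Δ P fz ≡ l →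
    l₁ ≤ l₂ → l₂ ≤ l → + 1 ≤ l₁ →
    (a b : ℤ) → Δ P (a , b , + 1) < l →
    ((+ ∣ a ∣) * l₁ ≤ + 2 * l - + 1 + (+ ∣ b ∣) * l₂)
    × ((+ ∣ b ∣) * l₂ ≤ + 2 * l - + 1 + (+ ∣ a ∣) * l₁)
mainTheorem6 P _ _ _ refl refl refl _ _ _ a b Δf<l =
    ≤-trans (∣c∣*Δ≤Δ+∣d∣*Δ+Δ P fx f fy fz a b (ax≡f-by-z a b)) (i<j⇒i+k+j≤2j-1+k _ Δf<l)
  , ≤-trans (∣c∣*Δ≤Δ+∣d∣*Δ+Δ P fy f fx fz b a (by≡f-ax-z a b)) (i<j⇒i+k+j≤2j-1+k _ Δf<l)
  where
  f : LinFun
  f = (a , b , + 1)
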